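{- Let $r=r(n)\ge3$ and $m=m(n)\ge1$ be integers with $m=o(r^{ -3}n^{3/2})$, let $K$ be a linear $r$-graph on $[n]$ with edges $e_1,\dots,e_k$, and let $1\le i\le k$. Let $H\in\mathcal{L}_r(n,m-1)$ and let $N_r$ be the set of $r$-subsets of $[n]$, distinct from $e_i$, no two of whose vertices belong to a common edge of $H$. Then, as $n\to\infty$, \[ |N_r|=\Bigl[N-\binom r2 m\binom{n-2}{r-2}\Bigr]\Bigl(1+O\Bigl(\frac{r^4}{n^2}+\frac{r^6m^2}{n^3}\Bigr)\Bigr). \]
   Context: An $r$-graph on $[n]$ is a set of $r$-subsets of $[n]$ (edges); it is linear if any two distinct edges share at most one vertex. $\mathcal{L}_r(n,m')$ is the set of linear $r$-graphs on $[n]$ with $m'$ edges. $N=\binom nr$. -}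

module Defs where

open import Data.Nat using (ℕ; zero; suc; _≤_; _≤?_)
open import Data.Nat.Properties using (_≟_)
open import Data.Bool using () renaming (_≟_ to _≟ᴮ_)
open import Data.Fin using (Fin)
open import Data.Fin.Subset using (Subset; inside; outside; ∣_∣; _∩_)
open import Data.Vec using (_∷_; [])
open import Data.Vec.Properties using (≡-dec)
open import Data.List using (List; []; _∷_; _++_; map; filter; length; lookup)
open import Data.List.Relation.Unary.All using (All; all?)
open import Data.List.Relation.Unary.Unique.Propositional using (Unique)
open import Data.Product using (_×_)
open import Relation.Binary.PropositionalEquality using (_≡_; _≢_)
open import Relation.Nullary using (Dec; ¬?; _×-dec_)

allSubsets : (n : ℕ) → List (Subset n)
allSubsets zero = [] ∷ []
allSubsets (suc n) = map (inside ∷_) (allSubsets n) ++ map (outside ∷_) (allSubsets n)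

IsRGraph : (n r : ℕ) → List (Subset n) → Set
IsRGraph n r G = Unique G × All (λ e → ∣ e ∣ ≡ r) G

IsLinear : {n : ℕ} → List (Subset n) → Set
IsLinear G = ∀ (a b : Fin (length G)) → a ≢ b → ∣ lookup G a ∩ lookup G b ∣ ≤ 1

InL : (r n m' : ℕ) → List (Subset n) → Set
InL r n m' H = IsRGraph n r H × IsLinear H × length H ≡ m'

inNr? : {n : ℕ} (r : ℕ) (H : List (Subset n)) (e : Subset n) (s : Subset n) → Dec _
inNr? r H e s = (∣ s ∣ ≟ r) ×-dec (¬? (≡-dec _≟ᴮ_ s e) ×-dec all? (λ f → ∣ s ∩ f ∣ ≤? 1) H)

cardNr : {n : ℕ} (r : ℕ) (H : List (Subset n)) (e : Subset n) → ℕ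
cardNr {n} r H e = length (filter (inNr? r H e) (allSubsets n))

module Submission where

-- Call s an r-subset bad if some edge of H contains two of its vertices, and let
-- hits k H s = Σ_f C(|s ∩ f|, k).  Summing C(|s ∩ X|, k) over all r-subsets s gives
-- C(|X|, k) C(n − k, r − k), so Σ_s hits 2 H s = (m − 1) C(r,2) C(n−2, r−2).  Bonferroni
-- brackets the number of bad sets: [s bad] ≤ hits 2 H s, and, since H is linear,
-- hits 2 H s ≤ [s bad] + 2 hits 3 H s + Σ_{f,g} C(|s ∩ (f ∪ g)|, 3).  Hence |N_r| lies within
-- 1 + C(r,2) C(n−2, r−2) + O(m² r⁶ C(n−3, r−3)) of M = N − m C(r,2) C(n−2, r−2).  The
-- absorption identities r(r−1) N = n(n−1) C(n−2, r−2) and r(r−1)(r−2) N = n(n−1)(n−2) C(n−3, r−3)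
-- turn this into n³ |error| = O(N (r⁴ n + r⁶ m²)), and m r⁴ ≤ n²/4 gives N ≤ 2M.

open import Defs
open import Data.Bool using (Bool; true; false; not)
open import Data.Fin using (Fin)
open import Data.Fin.Subset using (Subset)
open import Data.List using (List; []; _∷_; map; filter; length; lookup)
open import Data.List.Relation.Unary.All as All using (All; []; _∷_)
open import Data.Nat
open import Data.Nat.Properties
open import Data.Nat.Combinatorics using (_C_; nCk+nC[k+1]≡[n+1]C[k+1])
open import Data.Nat.ListAction using (sum)
open import Data.Nat.Tactic.RingSolver using (solve-∀)
open import Data.Product using (Σ; _,_; proj₁; proj₂)
open import Data.Sum using (inj₁; inj₂)
open import Relation.Binary.PropositionalEquality
open import Relation.Nullary using (yes; no; does)
open import Relation.Unary using (Decidable)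
open import Algebra.Properties.CommutativeSemigroup *-commutativeSemigroup using ()
  renaming (x∙yz≈y∙xz to *-leftComm)
open import Algebra.Properties.CommutativeSemigroup +-commutativeSemigroup using ()
  renaming (interchange to +-interchange)

-- Binomial coefficients by Pascal's rule: unlike _C_ (defined by division) they unfold by pattern matching.

choose : ℕ → ℕ → ℕ
choose n       zero    = 1
choose zero    (suc k) = 0
choose (suc n) (suc k) = choose n k + choose n (suc k)

C≡choose : ∀ n k → n C k ≡ choose n k
C≡choose n       zero    = refl
C≡choose zero    (suc k) = refl
C≡choose (suc n) (suc k) = begin
  suc n C suc k                  ≡⟨ nCk+nC[k+1]≡[n+1]C[k+1] n k ⟨
  n C k + n C suc k              ≡⟨ cong₂ _+_ (C≡choose n k) (C≡choose n (suc k)) ⟩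
  choose n k + choose n (suc k)  ∎
  where open ≡-Reasoning

choose-< : ∀ {a k} → a < k → choose a k ≡ 0
choose-< {zero}  {suc k} _         = refl
choose-< {suc a} {suc k} (s≤s a<k) = cong₂ _+_ (choose-< a<k) (choose-< (m<n⇒m<1+n a<k))

choose-pos : ∀ {a k} → k ≤ a → 1 ≤ choose a k
choose-pos {a}     {zero}  _         = ≤-refl
choose-pos {suc a} {suc k} (s≤s k≤a) = ≤-trans (choose-pos k≤a) (m≤m+n _ _)

choose-monoˡ-≤ : ∀ k {a b} → a ≤ b → choose a k ≤ choose b k
choose-monoˡ-≤ zero    _                       = ≤-refl
choose-monoˡ-≤ (suc k) z≤n                     = z≤n
choose-monoˡ-≤ (suc k) (s≤s a≤b) = +-mono-≤ (choose-monoˡ-≤ k a≤b) (choose-monoˡ-≤ (suc k) a≤b)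

choose≤^ : ∀ x k → choose x k ≤ x ^ k
choose≤^ x       zero    = ≤-refl
choose≤^ zero    (suc k) = z≤n
choose≤^ (suc x) (suc k) = begin
  choose x k + choose x (suc k)  ≤⟨ +-mono-≤ (choose≤^ x k) (choose≤^ x (suc k)) ⟩
  x ^ k + x * x ^ k              ≤⟨ *-monoʳ-≤ (suc x) (^-monoˡ-≤ k (n≤1+n x)) ⟩
  suc x * suc x ^ k              ∎
  where open ≤-Reasoning

choose-1 : ∀ x → choose x 1 ≡ x
choose-1 zero    = refl
choose-1 (suc x) = cong suc (choose-1 x)

choose-absorb : ∀ n k → suc k * choose (suc n) (suc k) ≡ suc n * choose n k
choose-absorb zero    zero    = refl
choose-absorb zero    (suc k) = *-zeroʳ (suc (suc k))
choose-absorb (suc n) zero    = trans (*-identityˡ _) (trans (choose-1 (suc (suc n))) (sym (*-identityʳ _)))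
choose-absorb (suc n) (suc k) = begin
  suc (suc k) * (c₁ + c₂)                 ≡⟨ *-distribˡ-+ (suc (suc k)) c₁ c₂ ⟩
  suc (suc k) * c₁ + suc (suc k) * c₂     ≡⟨ cong (suc (suc k) * c₁ +_) (choose-absorb n (suc k)) ⟩
  c₁ + suc k * c₁ + suc n * b₂            ≡⟨ cong (λ z → c₁ + z + suc n * b₂) (choose-absorb n k) ⟩
  c₁ + suc n * b₁ + suc n * b₂            ≡⟨ +-assoc c₁ _ _ ⟩
  c₁ + (suc n * b₁ + suc n * b₂)          ≡⟨ cong (c₁ +_) (*-distribˡ-+ (suc n) b₁ b₂) ⟨
  c₁ + suc n * (b₁ + b₂)                  ∎
  where
  open ≡-Reasoning
  c₁ = choose (suc n) (suc k)
  c₂ = choose (suc n) (suc (suc k))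
  b₁ = choose n k
  b₂ = choose n (suc k)

choose-absorb₂ : ∀ a k →
  suc k * (suc (suc k) * choose (2 + a) (2 + k)) ≡ suc (suc a) * (suc a * choose a k)
choose-absorb₂ a k = begin
  suc k * (suc (suc k) * choose (2 + a) (2 + k))  ≡⟨ cong (suc k *_) (choose-absorb (suc a) (suc k)) ⟩
  suc k * (suc (suc a) * choose (1 + a) (1 + k))  ≡⟨ *-leftComm (suc k) (suc (suc a)) (choose (1 + a) (1 + k)) ⟩
  suc (suc a) * (suc k * choose (1 + a) (1 + k))  ≡⟨ cong (suc (suc a) *_) (choose-absorb a k) ⟩
  suc (suc a) * (suc a * choose a k)              ∎
  where open ≡-Reasoning

choose-absorb₃ : ∀ a k →
  suc k * (suc (suc k) * (suc (suc (suc k)) * choose (3 + a) (3 + k)))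
    ≡ suc (suc (suc a)) * (suc (suc a) * (suc a * choose a k))
choose-absorb₃ a k = begin
  suc k * (suc (suc k) * (suc (suc (suc k)) * choose (3 + a) (3 + k)))
    ≡⟨ cong (λ z → suc k * (suc (suc k) * z)) (choose-absorb (2 + a) (2 + k)) ⟩
  suc k * (suc (suc k) * (suc (suc (suc a)) * choose (2 + a) (2 + k)))
    ≡⟨ cong (suc k *_) (*-leftComm (suc (suc k)) (suc (suc (suc a))) (choose (2 + a) (2 + k))) ⟩
  suc k * (suc (suc (suc a)) * (suc (suc k) * choose (2 + a) (2 + k)))
    ≡⟨ *-leftComm (suc k) (suc (suc (suc a))) (suc (suc k) * choose (2 + a) (2 + k)) ⟩
  suc (suc (suc a)) * (suc k * (suc (suc k) * choose (2 + a) (2 + k)))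
    ≡⟨ cong (suc (suc (suc a)) *_) (choose-absorb₂ a k) ⟩
  suc (suc (suc a)) * (suc (suc a) * (suc a * choose a k))
    ∎
  where open ≡-Reasoning

choose-quadratic-weight : ∀ a k →
  (2 + a) * (2 + a) * choose a k ≤ 2 * ((2 + k) * (2 + k)) * choose (2 + a) (2 + k)
choose-quadratic-weight a k = begin
  (2 + a) * (2 + a) * choose a k
    ≤⟨ *-monoˡ-≤ (choose a k) (*-monoʳ-≤ (2 + a) (+-monoʳ-≤ 2 (m≤m+n a (a + 0)))) ⟩
  (2 + a) * (2 + (a + (a + 0))) * choose a k
    ≡⟨ reshuffleₗ a (choose a k) ⟩
  2 * ((2 + a) * ((1 + a) * choose a k))
    ≡⟨ cong (2 *_) (choose-absorb₂ a k) ⟨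
  2 * ((1 + k) * ((2 + k) * choose (2 + a) (2 + k)))
    ≤⟨ *-monoʳ-≤ 2 (*-monoˡ-≤ ((2 + k) * choose (2 + a) (2 + k)) (n≤1+n (1 + k))) ⟩
  2 * ((2 + k) * ((2 + k) * choose (2 + a) (2 + k)))
    ≡⟨ reshuffleᵣ (2 + k) (choose (2 + a) (2 + k)) ⟩
  2 * ((2 + k) * (2 + k)) * choose (2 + a) (2 + k)
    ∎
  where
  open ≤-Reasoning
  reshuffleₗ : ∀ a c → (2 + a) * (2 + (a + (a + 0))) * c ≡ 2 * ((2 + a) * ((1 + a) * c))
  reshuffleₗ = solve-∀
  reshuffleᵣ : ∀ x c → 2 * (x * (x * c)) ≡ 2 * (x * x) * c
  reshuffleᵣ = solve-∀

choose-cubic-weight : ∀ a k →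
  (3 + a) * (3 + a) * (3 + a) * choose a k
    ≤ 6 * ((3 + k) * (3 + k) * (3 + k)) * choose (3 + a) (3 + k)
choose-cubic-weight a k = begin
  (3 + a) * (3 + a) * (3 + a) * choose a k
    ≤⟨ *-monoˡ-≤ (choose a k) (*-mono-≤ (*-monoʳ-≤ (3 + a) (+-monoʳ-≤ 3 (m≤m+n a (1 + (a + 0)))))
                                        (+-monoʳ-≤ 3 (m≤m+n a (a + (a + 0))))) ⟩
  (3 + a) * (3 + (a + (1 + (a + 0)))) * (3 + (a + (a + (a + 0)))) * choose a k
    ≡⟨ reshuffleₗ a (choose a k) ⟩
  6 * ((3 + a) * ((2 + a) * ((1 + a) * choose a k)))
    ≡⟨ cong (6 *_) (choose-absorb₃ a k) ⟨
  6 * ((1 + k) * ((2 + k) * ((3 + k) * choose (3 + a) (3 + k))))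
    ≤⟨ *-monoʳ-≤ 6 (*-mono-≤ (m≤n+m (1 + k) 2)
                             (*-monoˡ-≤ ((3 + k) * choose (3 + a) (3 + k)) (n≤1+n (2 + k)))) ⟩
  6 * ((3 + k) * ((3 + k) * ((3 + k) * choose (3 + a) (3 + k))))
    ≡⟨ reshuffleᵣ (3 + k) (choose (3 + a) (3 + k)) ⟩
  6 * ((3 + k) * (3 + k) * (3 + k)) * choose (3 + a) (3 + k)
    ∎
  where
  open ≤-Reasoning
  reshuffleₗ : ∀ a c →
    (3 + a) * (3 + (a + (1 + (a + 0)))) * (3 + (a + (a + (a + 0)))) * c
      ≡ 6 * ((3 + a) * ((2 + a) * ((1 + a) * c)))
  reshuffleₗ = solve-∀
  reshuffleᵣ : ∀ x c → 6 * (x * (x * (x * c))) ≡ 6 * (x * x * x) * c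
  reshuffleᵣ = solve-∀

2*choose-2≤square : ∀ x → 2 * choose x 2 ≤ x * x
2*choose-2≤square zero    = z≤n
2*choose-2≤square (suc y) = begin
  2 * choose (suc y) 2  ≡⟨ choose-absorb y 1 ⟩
  suc y * choose y 1    ≡⟨ cong (suc y *_) (choose-1 y) ⟩
  suc y * y             ≤⟨ *-monoʳ-≤ (suc y) (n≤1+n y) ⟩
  suc y * suc y         ∎
  where open ≤-Reasoning

𝟙 : Bool → ℕ
𝟙 true  = 1
𝟙 false = 0

choose-2≤ : ∀ x → choose x 2 ≤ 𝟙 (not (does (x ≤? 1))) + 2 * choose x 3
choose-2≤ zero                = z≤n
choose-2≤ (suc zero)          = z≤n
choose-2≤ (suc (suc y)) = begin
  choose (suc y) 1 + choose (suc y) 2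
    ≤⟨ +-monoˡ-≤ (choose (suc y) 2) (s≤s (m≤m+n (choose y 1) (choose y 2))) ⟩
  1 + choose (suc y) 2 + choose (suc y) 2
    ≤⟨ +-mono-≤ (+-monoʳ-≤ 1 c₂≤c₃) c₂≤c₃ ⟩
  1 + choose (2 + y) 3 + choose (2 + y) 3
    ≡⟨ cong (λ z → suc (choose (2 + y) 3 + z)) (+-identityʳ (choose (2 + y) 3)) ⟨
  1 + 2 * choose (2 + y) 3
    ∎
  where
  open ≤-Reasoning
  c₂≤c₃ : choose (suc y) 2 ≤ choose (2 + y) 3
  c₂≤c₃ = m≤m+n (choose (suc y) 2) (choose (suc y) 3)

-- For n ≤ j both sides vanish because a ≤ n < 1 + j; otherwise n ∸ j = 1 + (n ∸ suc j)
-- and this is Pascal's rule.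
choose-pascal∸ : ∀ {a} n j r → a ≤ n →
  choose a (suc j) * (choose (n ∸ suc j) r + choose (n ∸ suc j) (suc r))
    ≡ choose a (suc j) * choose (n ∸ j) (suc r)
choose-pascal∸ zero    j r z≤n = refl
choose-pascal∸ {a} (suc n) j r a≤n with j ≤? n
... | yes j≤n = cong (λ z → choose a (suc j) * choose z (suc r)) (sym (+-∸-assoc 1 j≤n))
... | no  j≰n rewrite choose-< {a} {suc j} (s≤s (≤-trans a≤n (≰⇒> j≰n))) = refl

sum-map-mono : ∀ {A : Set} (xs : List A) {g h : A → ℕ} →
  All (λ x → g x ≤ h x) xs → sum (map g xs) ≤ sum (map h xs)
sum-map-mono []       []             = z≤n
sum-map-mono (x ∷ xs) (gx≤hx ∷ g≤h) = +-mono-≤ gx≤hx (sum-map-mono xs g≤h)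

sum-map-+ : ∀ {A : Set} (xs : List A) (g h : A → ℕ) →
  sum (map (λ x → g x + h x) xs) ≡ sum (map g xs) + sum (map h xs)
sum-map-+ []       g h = refl
sum-map-+ (x ∷ xs) g h = trans (cong (g x + h x +_) (sum-map-+ xs g h)) (+-interchange (g x) (h x) _ _)

sum-map-* : ∀ {A : Set} (xs : List A) c (g : A → ℕ) →
  sum (map (λ x → c * g x) xs) ≡ c * sum (map g xs)
sum-map-* []       c g = sym (*-zeroʳ c)
sum-map-* (x ∷ xs) c g = trans (cong (c * g x +_) (sum-map-* xs c g)) (sym (*-distribˡ-+ c _ _))

sum-map-≡const : ∀ {A : Set} {c} (xs : List A) {g : A → ℕ} →
  All (λ x → g x ≡ c) xs → sum (map g xs) ≡ length xs * c
sum-map-≡const []       []           = refl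
sum-map-≡const (x ∷ xs) (gx≡c ∷ all) = cong₂ _+_ gx≡c (sum-map-≡const xs all)

sum-map-≤const : ∀ {A : Set} {c} (xs : List A) {g : A → ℕ} →
  All (λ x → g x ≤ c) xs → sum (map g xs) ≤ length xs * c
sum-map-≤const []       []           = z≤n
sum-map-≤const (x ∷ xs) (gx≤c ∷ all) = +-mono-≤ gx≤c (sum-map-≤const xs all)

length-filter≡sum : ∀ {A : Set} {P : A → Set} (P? : Decidable P) (xs : List A) →
  length (filter P? xs) ≡ sum (map (λ x → 𝟙 (does (P? x))) xs)
length-filter≡sum P? []       = refl
length-filter≡sum P? (x ∷ xs) with does (P? x)
... | true  = cong suc (length-filter≡sum P? xs)
... | false = length-filter≡sum P? xs

-- Sums over the r-subsets of [n]

module Counting where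

  open import Data.Bool using (_∧_; if_then_else_) renaming (_≟_ to _≟ᴮ_)
  open import Data.Fin.Subset using (inside; outside; ∣_∣; _∩_; _∪_)
  open import Data.Fin.Subset.Properties using (∣p∣≤n; ∣p∩q∣≤∣p∣)
  open import Data.List using (_++_)
  open import Data.List.Properties using (map-++; map-∘; tabulate-lookup)
  open import Data.List.Relation.Unary.All using (all?)
  open import Data.List.Relation.Unary.AllPairs using (AllPairs; []; _∷_)
  open import Data.List.Relation.Unary.AllPairs.Properties using (tabulate⁺)
  open import Data.Nat.ListAction.Properties using (sum-++)
  open import Data.Vec using ([]; _∷_)
  open import Data.Vec.Properties using (≡-dec)
  open import Relation.Nullary using (Dec)

  sumAll : ∀ {n} → (Subset n → ℕ) → ℕ
  sumAll {zero}  g = g []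
  sumAll {suc n} g = sumAll (λ s → g (inside ∷ s)) + sumAll (λ s → g (outside ∷ s))

  sumSubsets : ∀ {n} → ℕ → (Subset n → ℕ) → ℕ
  sumSubsets {zero}  zero    g = g []
  sumSubsets {zero}  (suc t) g = 0
  sumSubsets {suc n} zero    g = sumSubsets zero (λ s → g (outside ∷ s))
  sumSubsets {suc n} (suc t) g =
    sumSubsets t (λ s → g (inside ∷ s)) + sumSubsets (suc t) (λ s → g (outside ∷ s))

  sum-allSubsets : ∀ n (g : Subset n → ℕ) → sum (map g (allSubsets n)) ≡ sumAll g
  sum-allSubsets zero    g = +-identityʳ (g [])
  sum-allSubsets (suc n) g = begin
    sum (map g (map (inside ∷_) ss ++ map (outside ∷_) ss))
      ≡⟨ cong sum (map-++ g (map (inside ∷_) ss) _) ⟩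
    sum (map g (map (inside ∷_) ss) ++ map g (map (outside ∷_) ss))
      ≡⟨ sum-++ (map g (map (inside ∷_) ss)) _ ⟩
    sum (map g (map (inside ∷_) ss)) + sum (map g (map (outside ∷_) ss))
      ≡⟨ cong₂ (λ u v → sum u + sum v) (map-∘ ss) (map-∘ ss) ⟨
    sum (map (λ s → g (inside ∷ s)) ss) + sum (map (λ s → g (outside ∷ s)) ss)
      ≡⟨ cong₂ _+_ (sum-allSubsets n _) (sum-allSubsets n _) ⟩
    sumAll g
      ∎
    where
    open ≡-Reasoning
    ss = allSubsets n

  sumAll-zero : ∀ {n} → sumAll {n} (λ _ → 0) ≡ 0
  sumAll-zero {zero}  = refl
  sumAll-zero {suc n} = cong₂ _+_ (sumAll-zero {n}) (sumAll-zero {n})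

  sumAll-cong : ∀ {n} {g h : Subset n → ℕ} → (∀ s → g s ≡ h s) → sumAll g ≡ sumAll h
  sumAll-cong {zero}  g≡h = g≡h []
  sumAll-cong {suc n} g≡h =
    cong₂ _+_ (sumAll-cong (λ s → g≡h (inside ∷ s))) (sumAll-cong (λ s → g≡h (outside ∷ s)))

  sumAll-restrict : ∀ {n} t (g : Subset n → ℕ) →
    sumAll (λ s → if does (∣ s ∣ ≟ t) then g s else 0) ≡ sumSubsets t g
  sumAll-restrict {zero}  zero    g = refl
  sumAll-restrict {zero}  (suc t) g = refl
  sumAll-restrict {suc n} zero    g = cong₂ _+_ (sumAll-zero {n}) (sumAll-restrict {n} zero _)
  sumAll-restrict {suc n} (suc t) g = cong₂ _+_ (sumAll-restrict {n} t _) (sumAll-restrict {n} (suc t) _)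

  sumSubsets≤sumAll : ∀ {n} t (g : Subset n → ℕ) → sumSubsets t g ≤ sumAll g
  sumSubsets≤sumAll {zero}  zero    g = ≤-refl
  sumSubsets≤sumAll {zero}  (suc t) g = z≤n
  sumSubsets≤sumAll {suc n} zero    g = ≤-trans (sumSubsets≤sumAll {n} zero _) (m≤n+m _ _)
  sumSubsets≤sumAll {suc n} (suc t) g = +-mono-≤ (sumSubsets≤sumAll {n} t _) (sumSubsets≤sumAll {n} (suc t) _)

  _==_ : ∀ {n} → Subset n → Subset n → Bool
  s == e = does (≡-dec _≟ᴮ_ s e)

  sumAll-== : ∀ {n} (e : Subset n) → sumAll (λ s → 𝟙 (s == e)) ≡ 1
  sumAll-== []                   = refl
  sumAll-== {suc n} (inside ∷ e)  = cong₂ _+_ (sumAll-== e) (sumAll-zero {n})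
  sumAll-== {suc n} (outside ∷ e) = cong₂ _+_ (sumAll-zero {n}) (sumAll-== e)

  sumSubsets-congOn : ∀ {n} t {g h : Subset n → ℕ} →
    (∀ s → ∣ s ∣ ≡ t → g s ≡ h s) → sumSubsets t g ≡ sumSubsets t h
  sumSubsets-congOn {zero}  zero    g≡h = g≡h [] refl
  sumSubsets-congOn {zero}  (suc t) g≡h = refl
  sumSubsets-congOn {suc n} zero    g≡h = sumSubsets-congOn {n} zero (λ s → g≡h (outside ∷ s))
  sumSubsets-congOn {suc n} (suc t) g≡h =
    cong₂ _+_ (sumSubsets-congOn {n} t (λ s ∣s∣≡t → g≡h (inside ∷ s) (cong suc ∣s∣≡t)))
              (sumSubsets-congOn {n} (suc t) (λ s → g≡h (outside ∷ s)))

  sumSubsets-mono : ∀ {n} t {g h : Subset n → ℕ} → (∀ s → g s ≤ h s) → sumSubsets t g ≤ sumSubsets t h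
  sumSubsets-mono {zero}  zero    g≤h = g≤h []
  sumSubsets-mono {zero}  (suc t) g≤h = ≤-refl
  sumSubsets-mono {suc n} zero    g≤h = sumSubsets-mono {n} zero (λ s → g≤h (outside ∷ s))
  sumSubsets-mono {suc n} (suc t) g≤h =
    +-mono-≤ (sumSubsets-mono {n} t (λ s → g≤h (inside ∷ s)))
             (sumSubsets-mono {n} (suc t) (λ s → g≤h (outside ∷ s)))

  sumSubsets-zero : ∀ {n} t → sumSubsets {n} t (λ _ → 0) ≡ 0
  sumSubsets-zero {zero}  zero    = refl
  sumSubsets-zero {zero}  (suc t) = refl
  sumSubsets-zero {suc n} zero    = sumSubsets-zero {n} zero
  sumSubsets-zero {suc n} (suc t) = cong₂ _+_ (sumSubsets-zero {n} t) (sumSubsets-zero {n} (suc t))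

  sumSubsets-+ : ∀ {n} t (g h : Subset n → ℕ) →
    sumSubsets t (λ s → g s + h s) ≡ sumSubsets t g + sumSubsets t h
  sumSubsets-+ {zero}  zero    g h = refl
  sumSubsets-+ {zero}  (suc t) g h = refl
  sumSubsets-+ {suc n} zero    g h = sumSubsets-+ {n} zero _ _
  sumSubsets-+ {suc n} (suc t) g h =
    trans (cong₂ _+_ (sumSubsets-+ {n} t _ _) (sumSubsets-+ {n} (suc t) _ _))
          (+-interchange (sumSubsets t (λ s → g (inside ∷ s))) _ _ _)

  sumSubsets-* : ∀ {n} t c (g : Subset n → ℕ) → sumSubsets t (λ s → c * g s) ≡ c * sumSubsets t g
  sumSubsets-* {zero}  zero    c g = refl
  sumSubsets-* {zero}  (suc t) c g = sym (*-zeroʳ c)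
  sumSubsets-* {suc n} zero    c g = sumSubsets-* {n} zero c _
  sumSubsets-* {suc n} (suc t) c g =
    trans (cong₂ _+_ (sumSubsets-* {n} t c _) (sumSubsets-* {n} (suc t) c _)) (sym (*-distribˡ-+ c _ _))

  sumSubsets-sum : ∀ {n} t {A : Set} (xs : List A) (g : A → Subset n → ℕ) →
    sumSubsets t (λ s → sum (map (λ x → g x s) xs)) ≡ sum (map (λ x → sumSubsets t (g x)) xs)
  sumSubsets-sum {n} t []       g = sumSubsets-zero {n} t
  sumSubsets-sum {n} t (x ∷ xs) g =
    trans (sumSubsets-+ {n} t (g x) _) (cong (sumSubsets t (g x) +_) (sumSubsets-sum t xs g))

  sumSubsets-count : ∀ n t → sumSubsets {n} t (λ _ → 1) ≡ choose n t
  sumSubsets-count zero    zero    = refl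
  sumSubsets-count zero    (suc t) = refl
  sumSubsets-count (suc n) zero    = sumSubsets-count n zero
  sumSubsets-count (suc n) (suc t) = cong₂ _+_ (sumSubsets-count n t) (sumSubsets-count n (suc t))

  sumSubsets-choose∩-vanish : ∀ {n} (X : Subset n) {t k} → t < k →
    sumSubsets t (λ s → choose (∣ s ∩ X ∣) k) ≡ 0
  sumSubsets-choose∩-vanish {n} X {t} t<k = trans
    (sumSubsets-congOn t λ s ∣s∣≡t →
      choose-< (≤-<-trans (∣p∩q∣≤∣p∣ s X) (subst (_< _) (sym ∣s∣≡t) t<k)))
    (sumSubsets-zero {n} t)

  sumSubsets-choose∩ : ∀ {n} (X : Subset n) k r →
    sumSubsets (k + r) (λ s → choose (∣ s ∩ X ∣) k) ≡ choose (∣ X ∣) k * choose (n ∸ k) r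

  sumSubsets-choose∩-step : ∀ {n} (X : Subset n) j r →
    sumSubsets (j + r) (λ s → choose (∣ s ∩ X ∣) (suc j)) + choose (∣ X ∣) (suc j) * choose (n ∸ suc j) r
      ≡ choose (∣ X ∣) (suc j) * choose (n ∸ j) r
  sumSubsets-choose∩-step X j zero =
    cong (_+ choose (∣ X ∣) (suc j) * 1) (sumSubsets-choose∩-vanish X (s≤s (≤-reflexive (+-identityʳ j))))
  sumSubsets-choose∩-step {n} X j (suc r) = begin
    sumSubsets (j + suc r) (λ s → choose (∣ s ∩ X ∣) (suc j)) + a * choose (n ∸ suc j) (suc r)
      ≡⟨ cong (λ t → sumSubsets t (λ s → choose (∣ s ∩ X ∣) (suc j)) + a * choose (n ∸ suc j) (suc r))
              (+-suc j r) ⟩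
    sumSubsets (suc j + r) (λ s → choose (∣ s ∩ X ∣) (suc j)) + a * choose (n ∸ suc j) (suc r)
      ≡⟨ cong (_+ a * choose (n ∸ suc j) (suc r)) (sumSubsets-choose∩ X (suc j) r) ⟩
    a * choose (n ∸ suc j) r + a * choose (n ∸ suc j) (suc r)
      ≡⟨ *-distribˡ-+ a _ _ ⟨
    a * (choose (n ∸ suc j) r + choose (n ∸ suc j) (suc r))
      ≡⟨ choose-pascal∸ n j r (∣p∣≤n X) ⟩
    a * choose (n ∸ j) (suc r)
      ∎
    where
    open ≡-Reasoning
    a = choose (∣ X ∣) (suc j)

  sumSubsets-choose∩ {n} X zero r = trans (sumSubsets-count n r) (sym (*-identityˡ _))
  sumSubsets-choose∩ [] (suc j) r = refl
  sumSubsets-choose∩ {suc n} (inside ∷ X) (suc j) r = begin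
    sumSubsets (j + r) (λ s → choose (∣ s ∩ X ∣) j + choose (∣ s ∩ X ∣) (suc j))
      + sumSubsets (suc j + r) (λ s → choose (∣ s ∩ X ∣) (suc j))
      ≡⟨ cong₂ _+_ (sumSubsets-+ {n} (j + r) _ _) (sumSubsets-choose∩ X (suc j) r) ⟩
    sumSubsets (j + r) (λ s → choose (∣ s ∩ X ∣) j) + sumSubsets (j + r) (λ s → choose (∣ s ∩ X ∣) (suc j))
      + a₁ * choose (n ∸ suc j) r
      ≡⟨ +-assoc (sumSubsets (j + r) (λ s → choose (∣ s ∩ X ∣) j)) _ _ ⟩
    sumSubsets (j + r) (λ s → choose (∣ s ∩ X ∣) j)
      + (sumSubsets (j + r) (λ s → choose (∣ s ∩ X ∣) (suc j)) + a₁ * choose (n ∸ suc j) r)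
      ≡⟨ cong₂ _+_ (sumSubsets-choose∩ X j r) (sumSubsets-choose∩-step X j r) ⟩
    a₀ * choose (n ∸ j) r + a₁ * choose (n ∸ j) r
      ≡⟨ *-distribʳ-+ (choose (n ∸ j) r) a₀ a₁ ⟨
    (a₀ + a₁) * choose (n ∸ j) r
      ∎
    where
    open ≡-Reasoning
    a₀ = choose (∣ X ∣) j
    a₁ = choose (∣ X ∣) (suc j)
  sumSubsets-choose∩ (outside ∷ X) (suc j) r =
    trans (cong (sumSubsets (j + r) (λ s → choose (∣ s ∩ X ∣) (suc j)) +_) (sumSubsets-choose∩ X (suc j) r))
          (sumSubsets-choose∩-step X j r)

  ∣p∪q∣≤∣p∣+∣q∣ : ∀ {n} (p q : Subset n) → ∣ p ∪ q ∣ ≤ ∣ p ∣ + ∣ q ∣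
  ∣p∪q∣≤∣p∣+∣q∣ []            []            = z≤n
  ∣p∪q∣≤∣p∣+∣q∣ (inside  ∷ p) (inside  ∷ q) rewrite +-suc ∣ p ∣ ∣ q ∣ = s≤s (m≤n⇒m≤1+n (∣p∪q∣≤∣p∣+∣q∣ p q))
  ∣p∪q∣≤∣p∣+∣q∣ (inside  ∷ p) (outside ∷ q) = s≤s (∣p∪q∣≤∣p∣+∣q∣ p q)
  ∣p∪q∣≤∣p∣+∣q∣ (outside ∷ p) (inside  ∷ q) rewrite +-suc ∣ p ∣ ∣ q ∣ = s≤s (∣p∪q∣≤∣p∣+∣q∣ p q)
  ∣p∪q∣≤∣p∣+∣q∣ (outside ∷ p) (outside ∷ q) = ∣p∪q∣≤∣p∣+∣q∣ p q

  ∣p∩q∣+∣p∩r∣≤∣p∩[q∪r]∣+∣q∩r∣ : ∀ {n} (p q r : Subset n) →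
    ∣ p ∩ q ∣ + ∣ p ∩ r ∣ ≤ ∣ p ∩ (q ∪ r) ∣ + ∣ q ∩ r ∣
  ∣p∩q∣+∣p∩r∣≤∣p∩[q∪r]∣+∣q∩r∣ []      []      []      = z≤n
  ∣p∩q∣+∣p∩r∣≤∣p∩[q∪r]∣+∣q∩r∣ (x ∷ p) (y ∷ q) (z ∷ r) = cons x y z
    where
    ih : ∣ p ∩ q ∣ + ∣ p ∩ r ∣ ≤ ∣ p ∩ (q ∪ r) ∣ + ∣ q ∩ r ∣
    ih = ∣p∩q∣+∣p∩r∣≤∣p∩[q∪r]∣+∣q∩r∣ p q r
    cons : ∀ x y z → let p′ = x ∷ p; q′ = y ∷ q; r′ = z ∷ r in
      ∣ p′ ∩ q′ ∣ + ∣ p′ ∩ r′ ∣ ≤ ∣ p′ ∩ (q′ ∪ r′) ∣ + ∣ q′ ∩ r′ ∣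
    cons inside  inside  inside
      rewrite +-suc ∣ p ∩ q ∣ ∣ p ∩ r ∣ | +-suc ∣ p ∩ (q ∪ r) ∣ ∣ q ∩ r ∣ = s≤s (s≤s ih)
    cons inside  inside  outside = s≤s ih
    cons inside  outside inside  rewrite +-suc ∣ p ∩ q ∣ ∣ p ∩ r ∣ = s≤s ih
    cons inside  outside outside = ih
    cons outside inside  inside  rewrite +-suc ∣ p ∩ (q ∪ r) ∣ ∣ q ∩ r ∣ = m≤n⇒m≤1+n ih
    cons outside inside  outside = ih
    cons outside outside inside  = ih
    cons outside outside outside = ih

  two-hits⇒three : ∀ {n} (s f g : Subset n) →
    2 ≤ ∣ s ∩ f ∣ → 2 ≤ ∣ s ∩ g ∣ → ∣ f ∩ g ∣ ≤ 1 → 3 ≤ ∣ s ∩ (f ∪ g) ∣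
  two-hits⇒three s f g 2≤sf 2≤sg fg≤1 = +-cancelʳ-≤ 1 3 ∣ s ∩ (f ∪ g) ∣ (begin
    3 + 1                              ≤⟨ +-mono-≤ 2≤sf 2≤sg ⟩
    ∣ s ∩ f ∣ + ∣ s ∩ g ∣              ≤⟨ ∣p∩q∣+∣p∩r∣≤∣p∩[q∪r]∣+∣q∩r∣ s f g ⟩
    ∣ s ∩ (f ∪ g) ∣ + ∣ f ∩ g ∣        ≤⟨ +-monoʳ-≤ ∣ s ∩ (f ∪ g) ∣ fg≤1 ⟩
    ∣ s ∩ (f ∪ g) ∣ + 1                ∎)
    where open ≤-Reasoning

  -- Bad r-subsets and the Bonferroni bounds

  good : ∀ {n} → List (Subset n) → Subset n → Bool
  good H s = does (all? (λ f → ∣ s ∩ f ∣ ≤? 1) H)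

  inNrᵇ : ∀ {n} → List (Subset n) → Subset n → Subset n → Bool
  inNrᵇ H e s = not (s == e) ∧ good H s

  hits : ∀ {n} → ℕ → List (Subset n) → Subset n → ℕ
  hits k H s = sum (map (λ f → choose (∣ s ∩ f ∣) k) H)

  𝟙-bad≤ : ∀ {n} (H : List (Subset n)) s → 𝟙 (not (good H s)) ≤ hits 2 H s
  𝟙-bad≤ []      s = z≤n
  𝟙-bad≤ (f ∷ H) s = by-cases (∣ s ∩ f ∣ ≤? 1)
    where
    by-cases : (d : Dec (∣ s ∩ f ∣ ≤ 1)) →
      𝟙 (not (does d ∧ good H s)) ≤ choose (∣ s ∩ f ∣) 2 + hits 2 H s
    by-cases (yes _)    = ≤-trans (𝟙-bad≤ H s) (m≤n+m _ _)
    by-cases (no  sf≰1) = ≤-trans (choose-pos (≰⇒> sf≰1)) (m≤m+n _ _)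

  𝟙-heavy≤choose-3 : ∀ {n} (s f g : Subset n) → 2 ≤ ∣ s ∩ f ∣ → ∣ f ∩ g ∣ ≤ 1 →
    𝟙 (not (does (∣ s ∩ g ∣ ≤? 1))) ≤ choose (∣ s ∩ (f ∪ g) ∣) 3
  𝟙-heavy≤choose-3 s f g 2≤sf fg≤1 = by-cases (∣ s ∩ g ∣ ≤? 1)
    where
    by-cases : (d : Dec (∣ s ∩ g ∣ ≤ 1)) → 𝟙 (not (does d)) ≤ choose (∣ s ∩ (f ∪ g) ∣) 3
    by-cases (yes _)    = z≤n
    by-cases (no  sg≰1) = choose-pos (two-hits⇒three s f g 2≤sf (≰⇒> sg≰1) fg≤1)

  heavyEdges : ∀ {n} → List (Subset n) → Subset n → ℕ
  heavyEdges H s = sum (map (λ f → 𝟙 (not (does (∣ s ∩ f ∣ ≤? 1)))) H)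

  pairHits : ∀ {n} → List (Subset n) → Subset n → ℕ
  pairHits []      s = 0
  pairHits (f ∷ H) s = sum (map (λ g → choose (∣ s ∩ (f ∪ g) ∣) 3) H) + pairHits H s

  -- The first edge meeting s twice is paid for by [s bad]; any later one, g, meets that
  -- edge f in at most one vertex, so s meets f ∪ g in at least three.
  heavyEdges≤ : ∀ {n} (H : List (Subset n)) s → AllPairs (λ f g → ∣ f ∩ g ∣ ≤ 1) H →
    heavyEdges H s ≤ 𝟙 (not (good H s)) + pairHits H s
  heavyEdges≤ []      s []               = z≤n
  heavyEdges≤ (f ∷ H) s (f-lin ∷ H-lin) = by-cases (∣ s ∩ f ∣ ≤? 1)
    where
    pairsWithf = sum (map (λ g → choose (∣ s ∩ (f ∪ g) ∣) 3) H)
    by-cases : (d : Dec (∣ s ∩ f ∣ ≤ 1)) →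
      𝟙 (not (does d)) + heavyEdges H s ≤ 𝟙 (not (does d ∧ good H s)) + (pairsWithf + pairHits H s)
    by-cases (yes _)    = ≤-trans (heavyEdges≤ H s H-lin) (+-monoʳ-≤ _ (m≤n+m (pairHits H s) pairsWithf))
    by-cases (no  sf≰1) = s≤s (≤-trans
      (sum-map-mono H (All.map (𝟙-heavy≤choose-3 s f _ (≰⇒> sf≰1)) f-lin))
      (m≤m+n pairsWithf (pairHits H s)))

  linear⇒AllPairs : ∀ {n} (H : List (Subset n)) → IsLinear H → AllPairs (λ f g → ∣ f ∩ g ∣ ≤ 1) H
  linear⇒AllPairs H linear = subst (AllPairs _) (tabulate-lookup H) (tabulate⁺ (λ {i} {j} → linear i j))

  sumSubsets-hits : ∀ {n} k ρ (H : List (Subset n)) → All (λ f → ∣ f ∣ ≡ k + ρ) H →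
    sumSubsets (k + ρ) (hits k H)
      ≡ length H * (choose (k + ρ) k * choose (n ∸ k) ρ)
  sumSubsets-hits k ρ H uniform = begin
    sumSubsets (k + ρ) (λ s → sum (map (λ f → choose (∣ s ∩ f ∣) k) H))
      ≡⟨ sumSubsets-sum (k + ρ) H (λ f s → choose (∣ s ∩ f ∣) k) ⟩
    sum (map (λ f → sumSubsets (k + ρ) (λ s → choose (∣ s ∩ f ∣) k)) H)
      ≡⟨ sum-map-≡const H (All.map (λ {f} ∣f∣≡k+ρ → trans (sumSubsets-choose∩ f k ρ)
                                     (cong (λ x → choose x k * _) ∣f∣≡k+ρ)) uniform) ⟩
    length H * (choose (k + ρ) k * _)
      ∎
    where open ≡-Reasoning

  sumSubsets-pairHits≤ : ∀ {n} ρ {R} (H : List (Subset n)) → All (λ f → ∣ f ∣ ≡ R) H →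
    sumSubsets (3 + ρ) (pairHits H) ≤ length H * length H * (choose (R + R) 3 * choose (n ∸ 3) ρ)
  sumSubsets-pairHits≤ {n} ρ []      []                  = ≤-reflexive (sumSubsets-zero {n} (3 + ρ))
  sumSubsets-pairHits≤ {n} ρ {R} (f ∷ H) (∣f∣≡R ∷ uniform) = begin
    sumSubsets (3 + ρ) (λ s → sum (map (λ g → choose (∣ s ∩ (f ∪ g) ∣) 3) H) + pairHits H s)
      ≡⟨ sumSubsets-+ (3 + ρ) _ (pairHits H) ⟩
    sumSubsets (3 + ρ) (λ s → sum (map (λ g → choose (∣ s ∩ (f ∪ g) ∣) 3) H))
      + sumSubsets (3 + ρ) (pairHits H)
      ≡⟨ cong (_+ sumSubsets (3 + ρ) (pairHits H))
              (sumSubsets-sum (3 + ρ) H (λ g s → choose (∣ s ∩ (f ∪ g) ∣) 3)) ⟩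
    sum (map (λ g → sumSubsets (3 + ρ) (λ s → choose (∣ s ∩ (f ∪ g) ∣) 3)) H)
      + sumSubsets (3 + ρ) (pairHits H)
      ≤⟨ +-mono-≤ (sum-map-≤const H (All.map pair≤ uniform)) (sumSubsets-pairHits≤ ρ H uniform) ⟩
    l * K + l * l * K
      ≤⟨ m≤m+n (l * K + l * l * K) (K + l * K) ⟩
    l * K + l * l * K + (K + l * K)
      ≡⟨ square l K ⟩
    suc l * suc l * K
      ∎
    where
    open ≤-Reasoning
    l = length H
    K = choose (R + R) 3 * choose (n ∸ 3) ρ
    pair≤ : ∀ {g} → ∣ g ∣ ≡ R → sumSubsets (3 + ρ) (λ s → choose (∣ s ∩ (f ∪ g) ∣) 3) ≤ K
    pair≤ {g} ∣g∣≡R = begin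
      sumSubsets (3 + ρ) (λ s → choose (∣ s ∩ (f ∪ g) ∣) 3) ≡⟨ sumSubsets-choose∩ (f ∪ g) 3 ρ ⟩
      choose (∣ f ∪ g ∣) 3 * choose (n ∸ 3) ρ               ≤⟨ *-monoˡ-≤ _ (choose-monoˡ-≤ 3 ∣f∪g∣≤R+R) ⟩
      K                                                      ∎
      where
      ∣f∪g∣≤R+R : ∣ f ∪ g ∣ ≤ R + R
      ∣f∪g∣≤R+R = subst (∣ f ∪ g ∣ ≤_) (cong₂ _+_ ∣f∣≡R ∣g∣≡R) (∣p∪q∣≤∣p∣+∣q∣ f g)
    square : ∀ l K → l * K + l * l * K + (K + l * K) ≡ suc l * suc l * K
    square = solve-∀

  𝟙-complement : ∀ b → 𝟙 b + 𝟙 (not b) ≡ 1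
  𝟙-complement true  = refl
  𝟙-complement false = refl

  𝟙-∧-≤ : ∀ b c → 𝟙 (c ∧ b) ≤ 𝟙 b
  𝟙-∧-≤ b     true  = ≤-refl
  𝟙-∧-≤ b     false = z≤n

  𝟙-≤-∧-not+ : ∀ b c → 𝟙 b ≤ 𝟙 (not c ∧ b) + 𝟙 c
  𝟙-≤-∧-not+ true  true  = s≤s z≤n
  𝟙-≤-∧-not+ true  false = s≤s z≤n
  𝟙-≤-∧-not+ false c     = z≤n

  cardNr≡sumSubsets : ∀ {n} r (H : List (Subset n)) e →
    cardNr r H e ≡ sumSubsets r (λ s → 𝟙 (inNrᵇ H e s))
  cardNr≡sumSubsets {n} r H e = begin
    length (filter (inNr? r H e) (allSubsets n))
      ≡⟨ length-filter≡sum (inNr? r H e) (allSubsets n) ⟩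
    sum (map (λ s → 𝟙 (does (inNr? r H e s))) (allSubsets n))
      ≡⟨ sum-allSubsets n _ ⟩
    sumAll (λ s → 𝟙 (does (inNr? r H e s)))
      ≡⟨ sumAll-cong unfold-inNr ⟩
    sumAll (λ s → if does (∣ s ∣ ≟ r) then 𝟙 (inNrᵇ H e s) else 0)
      ≡⟨ sumAll-restrict r (λ s → 𝟙 (inNrᵇ H e s)) ⟩
    sumSubsets r (λ s → 𝟙 (inNrᵇ H e s))
      ∎
    where
    open ≡-Reasoning
    unfold-inNr : ∀ s → 𝟙 (does (inNr? r H e s))
      ≡ (if does (∣ s ∣ ≟ r) then 𝟙 (inNrᵇ H e s) else 0)
    unfold-inNr s with does (∣ s ∣ ≟ r)
    ... | true  = refl
    ... | false = refl

  module _ {n ρ} (H : List (Subset n)) (e : Subset n) (uniform : All (λ f → ∣ f ∣ ≡ 3 + ρ) H) where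

    private
      r #good #bad : ℕ
      r     = 3 + ρ
      #good = sumSubsets r (λ s → 𝟙 (good H s))
      #bad  = sumSubsets r (λ s → 𝟙 (not (good H s)))

    choose≡#good+#bad : choose n r ≡ #good + #bad
    choose≡#good+#bad = begin
      choose n r
        ≡⟨ sumSubsets-count n r ⟨
      sumSubsets {n} r (λ _ → 1)
        ≡⟨ sumSubsets-congOn {n} r (λ s _ → sym (𝟙-complement (good H s))) ⟩
      sumSubsets r (λ s → 𝟙 (good H s) + 𝟙 (not (good H s)))
        ≡⟨ sumSubsets-+ {n} r _ _ ⟩
      #good + #bad
        ∎
      where open ≡-Reasoning

    cardNr-lower : choose n r ≤ cardNr r H e + 1 + length H * (choose r 2 * choose (n ∸ 2) (1 + ρ))
    cardNr-lower = begin
      choose n r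
        ≡⟨ choose≡#good+#bad ⟩
      #good + #bad
        ≤⟨ +-mono-≤ (sumSubsets-mono {n} r (λ s → 𝟙-≤-∧-not+ (good H s) (s == e)))
                    (sumSubsets-mono {n} r (𝟙-bad≤ H)) ⟩
      sumSubsets r (λ s → 𝟙 (inNrᵇ H e s) + 𝟙 (s == e)) + sumSubsets r (hits 2 H)
        ≡⟨ cong₂ _+_ (sumSubsets-+ {n} r _ _) (sumSubsets-hits 2 (1 + ρ) H uniform) ⟩
      sumSubsets r (λ s → 𝟙 (inNrᵇ H e s)) + sumSubsets r (λ s → 𝟙 (s == e))
        + length H * (choose r 2 * choose (n ∸ 2) (1 + ρ))
        ≤⟨ +-monoˡ-≤ _ (+-mono-≤ (≤-reflexive (sym (cardNr≡sumSubsets r H e)))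
                                 (≤-trans (sumSubsets≤sumAll {n} r _) (≤-reflexive (sumAll-== e)))) ⟩
      cardNr r H e + 1 + length H * (choose r 2 * choose (n ∸ 2) (1 + ρ))
        ∎
      where open ≤-Reasoning

    hits-2≤ : AllPairs (λ f g → ∣ f ∩ g ∣ ≤ 1) H →
      ∀ s → hits 2 H s ≤ 𝟙 (not (good H s)) + pairHits H s + 2 * hits 3 H s
    hits-2≤ pairwise s = begin
      hits 2 H s
        ≤⟨ sum-map-mono H (All.universal (λ f → choose-2≤ ∣ s ∩ f ∣) H) ⟩
      sum (map (λ f → 𝟙 (not (does (∣ s ∩ f ∣ ≤? 1))) + 2 * choose (∣ s ∩ f ∣) 3) H)
        ≡⟨ sum-map-+ H _ _ ⟩
      heavyEdges H s + sum (map (λ f → 2 * choose (∣ s ∩ f ∣) 3) H)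
        ≡⟨ cong (heavyEdges H s +_) (sum-map-* H 2 (λ f → choose (∣ s ∩ f ∣) 3)) ⟩
      heavyEdges H s + 2 * hits 3 H s
        ≤⟨ +-monoˡ-≤ _ (heavyEdges≤ H s pairwise) ⟩
      𝟙 (not (good H s)) + pairHits H s + 2 * hits 3 H s
        ∎
      where open ≤-Reasoning

    cardNr-upper : IsLinear H →
      cardNr r H e + length H * (choose r 2 * choose (n ∸ 2) (1 + ρ))
        ≤ choose n r + (length H * length H * (choose (r + r) 3 * choose (n ∸ 3) ρ)
                        + 2 * (length H * (choose r 3 * choose (n ∸ 3) ρ)))
    cardNr-upper linear = begin
      cardNr r H e + length H * (choose r 2 * choose (n ∸ 2) (1 + ρ))
        ≡⟨ cong₂ _+_ (cardNr≡sumSubsets r H e) (sym (sumSubsets-hits 2 (1 + ρ) H uniform)) ⟩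
      sumSubsets r (λ s → 𝟙 (inNrᵇ H e s)) + sumSubsets r (hits 2 H)
        ≤⟨ +-mono-≤ (sumSubsets-mono {n} r (λ s → 𝟙-∧-≤ (good H s) (not (s == e))))
                    (sumSubsets-mono {n} r (hits-2≤ (linear⇒AllPairs H linear))) ⟩
      #good + sumSubsets r (λ s → 𝟙 (not (good H s)) + pairHits H s + 2 * hits 3 H s)
        ≡⟨ cong (#good +_) split ⟩
      #good + (#bad + (pairs + 2 * triples))
        ≡⟨ +-assoc #good #bad _ ⟨
      #good + #bad + (pairs + 2 * triples)
        ≤⟨ +-mono-≤ (≤-reflexive (sym choose≡#good+#bad))
                    (+-mono-≤ (sumSubsets-pairHits≤ ρ H uniform)
                              (≤-reflexive (cong (2 *_) (sumSubsets-hits 3 ρ H uniform)))) ⟩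
      choose n r + (length H * length H * (choose (r + r) 3 * choose (n ∸ 3) ρ)
                    + 2 * (length H * (choose r 3 * choose (n ∸ 3) ρ)))
        ∎
      where
      open ≤-Reasoning
      pairs triples : ℕ
      pairs   = sumSubsets r (pairHits H)
      triples = sumSubsets r (hits 3 H)
      split : sumSubsets r (λ s → 𝟙 (not (good H s)) + pairHits H s + 2 * hits 3 H s)
                ≡ #bad + (pairs + 2 * triples)
      split = begin-equality
        sumSubsets r (λ s → 𝟙 (not (good H s)) + pairHits H s + 2 * hits 3 H s)
          ≡⟨ sumSubsets-+ {n} r _ _ ⟩
        sumSubsets r (λ s → 𝟙 (not (good H s)) + pairHits H s) + sumSubsets r (λ s → 2 * hits 3 H s)
          ≡⟨ cong₂ _+_ (sumSubsets-+ {n} r _ _) (sumSubsets-* {n} r 2 (hits 3 H)) ⟩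
        #bad + pairs + 2 * triples
          ≡⟨ +-assoc #bad pairs _ ⟩
        #bad + (pairs + 2 * triples)
          ∎

open Counting using (cardNr-lower; cardNr-upper)

open import Data.Integer using (+_; ∣_∣; _⊖_) renaming (_-_ to _-ℤ_)
open import Data.Integer.Properties using (∣⊖∣-≤; ∣m⊖n∣≡∣n⊖m∣; [+m]-[+n]≡m⊖n; ⊖-≥)

-- Arithmetic of the error terms (the identities proved by solve-∀ spell powers out as products,
-- since the solver does not accept _^_ with a literal exponent)

∣⊖∣≤ : ∀ {x y d} → x ≤ y + d → y ≤ x + d → ∣ x ⊖ y ∣ ≤ d
∣⊖∣≤ {x} {y} x≤y+d y≤x+d with ≤-total x y
... | inj₁ x≤y = subst (_≤ _) (sym (∣⊖∣-≤ x≤y)) (m≤n+o⇒m∸n≤o y x y≤x+d)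
... | inj₂ y≤x =
  subst (_≤ _) (sym (trans (∣m⊖n∣≡∣n⊖m∣ x y) (∣⊖∣-≤ y≤x))) (m≤n+o⇒m∸n≤o x y x≤y+d)

∸-deviation : ∀ {c N a T P m} → P ≤ m → m ≤ suc P → m * a ≤ N →
  N ≤ c + 1 + P * a → c + P * a ≤ N + T → ∣ c ⊖ (N ∸ m * a) ∣ ≤ 1 + a + T
∸-deviation {c} {N} {a} {T} {P} {m} P≤m m≤1+P ma≤N lower upper = ∣⊖∣≤ c≤M+d M≤c+d
  where
  open ≤-Reasoning
  M = N ∸ m * a
  M+ma≡N : M + m * a ≡ N
  M+ma≡N = m∸n+n≡m ma≤N
  M≤c+d : M ≤ c + (1 + a + T)
  M≤c+d = ≤-trans (+-cancelʳ-≤ (m * a) M (c + 1) (begin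
    M + m * a      ≡⟨ M+ma≡N ⟩
    N              ≤⟨ lower ⟩
    c + 1 + P * a  ≤⟨ +-monoʳ-≤ (c + 1) (*-monoˡ-≤ a P≤m) ⟩
    c + 1 + m * a  ∎))
    (+-monoʳ-≤ c (s≤s z≤n))
  c≤M+d : c ≤ M + (1 + a + T)
  c≤M+d = ≤-trans (+-cancelʳ-≤ (P * a) c (M + a + T) (begin
    c + P * a             ≤⟨ upper ⟩
    N + T                 ≡⟨ cong (_+ T) M+ma≡N ⟨
    M + m * a + T         ≤⟨ +-monoˡ-≤ T (+-monoʳ-≤ M (*-monoˡ-≤ a m≤1+P)) ⟩
    M + suc P * a + T     ≡⟨ rearrange M a P T ⟩
    M + a + T + P * a     ∎))
    (≤-trans (≤-reflexive (+-assoc M a T)) (+-monoʳ-≤ M (n≤1+n (a + T))))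
    where
    rearrange : ∀ M a P T → M + suc P * a + T ≡ M + a + T + P * a
    rearrange = solve-∀

N≤2[N∸x] : ∀ {N x} → 2 * x ≤ N → N ≤ 2 * (N ∸ x)
N≤2[N∸x] {N} {x} 2x≤N = begin
  N                ≤⟨ m+n≤o⇒m≤o∸n N (+-monoʳ-≤ N 2x≤N) ⟩
  (N + N) ∸ 2 * x  ≡⟨ cong (λ z → (N + z) ∸ 2 * x) (+-identityʳ N) ⟨
  2 * N ∸ 2 * x    ≡⟨ *-distribˡ-∸ 2 N x ⟨
  2 * (N ∸ x)      ∎
  where open ≤-Reasoning

module _ {n r N A : ℕ} (quadratic : n * n * A ≤ 2 * (r * r) * N) where

  cube≤ : 1 ≤ r → 1 ≤ A → n ^ 3 ≤ 2 * (N * (r ^ 4 * n))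
  cube≤ 1≤r 1≤A = begin
    n ^ 3                  ≡⟨ reshuffleₗ n ⟩
    n * n * 1 * n          ≤⟨ *-monoˡ-≤ n (*-monoʳ-≤ (n * n) 1≤A) ⟩
    n * n * A * n          ≤⟨ *-monoˡ-≤ n quadratic ⟩
    2 * (r * r) * N * n    ≤⟨ *-monoˡ-≤ n (*-monoˡ-≤ N (*-monoʳ-≤ 2 r*r≤r*r*[r*r])) ⟩
    2 * (r * r * (r * r)) * N * n  ≡⟨ reshuffleᵣ r N n ⟩
    2 * (N * (r ^ 4 * n))  ∎
    where
    open ≤-Reasoning
    r*r≤r*r*[r*r] : r * r ≤ r * r * (r * r)
    r*r≤r*r*[r*r] = m≤m*n (r * r) (r * r) {{>-nonZero (*-mono-≤ 1≤r 1≤r)}}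
    reshuffleₗ : ∀ n → n * (n * (n * 1)) ≡ n * n * 1 * n
    reshuffleₗ = solve-∀
    reshuffleᵣ : ∀ r N n → 2 * (r * r * (r * r)) * N * n ≡ 2 * (N * (r * (r * (r * (r * 1))) * n))
    reshuffleᵣ = solve-∀

  cube*single≤ : n ^ 3 * (choose r 2 * A) ≤ N * (r ^ 4 * n)
  cube*single≤ = *-cancelˡ-≤ 2 (begin
    2 * (n ^ 3 * (choose r 2 * A))        ≡⟨ reshuffleₗ n (choose r 2) A ⟩
    2 * choose r 2 * (n * n * A) * n      ≤⟨ *-monoˡ-≤ n (*-mono-≤ (2*choose-2≤square r) quadratic) ⟩
    r * r * (2 * (r * r) * N) * n         ≡⟨ reshuffleᵣ r N n ⟩
    2 * (N * (r ^ 4 * n))                 ∎)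
    where
    open ≤-Reasoning
    reshuffleₗ : ∀ n q A → 2 * (n * (n * (n * 1)) * (q * A)) ≡ 2 * q * (n * n * A) * n
    reshuffleₗ = solve-∀
    reshuffleᵣ : ∀ r N n → r * r * (2 * (r * r) * N) * n ≡ 2 * (N * (r * (r * (r * (r * 1))) * n))
    reshuffleᵣ = solve-∀

  2m*single≤N : 1 ≤ n → ∀ m → 2 * (m * r ^ 4) ≤ n ^ 2 → 2 * (m * (choose r 2 * A)) ≤ N
  2m*single≤N 1≤n m small = *-cancelʳ-≤ _ _ (n * n) {{>-nonZero (*-mono-≤ 1≤n 1≤n)}} (begin
    2 * (m * (choose r 2 * A)) * (n * n)  ≡⟨ reshuffleₗ m (choose r 2) A n ⟩
    m * (2 * choose r 2 * (n * n * A))    ≤⟨ *-monoʳ-≤ m (*-mono-≤ (2*choose-2≤square r) quadratic) ⟩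
    m * (r * r * (2 * (r * r) * N))       ≡⟨ reshuffleᵣ m r N ⟩
    2 * (m * r ^ 4) * N                   ≤⟨ *-monoˡ-≤ N small ⟩
    n ^ 2 * N                             ≡⟨ square-comm n N ⟩
    N * (n * n)                           ∎)
    where
    open ≤-Reasoning
    reshuffleₗ : ∀ m q A n → 2 * (m * (q * A)) * (n * n) ≡ m * (2 * q * (n * n * A))
    reshuffleₗ = solve-∀
    reshuffleᵣ : ∀ m r N → m * (r * r * (2 * (r * r) * N)) ≡ 2 * (m * (r * (r * (r * (r * 1))))) * N
    reshuffleᵣ = solve-∀
    square-comm : ∀ n N → n * (n * 1) * N ≡ N * (n * n)
    square-comm = solve-∀

module _ {n r N B : ℕ} (cubic : n * n * n * B ≤ 6 * (r * r * r) * N) where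

  cube*pairs≤ : ∀ {P m} → P ≤ m → n ^ 3 * (P * P * (choose (r + r) 3 * B)) ≤ 48 * (N * (r ^ 6 * m ^ 2))
  cube*pairs≤ {P} {m} P≤m = begin
    n ^ 3 * (P * P * (choose (r + r) 3 * B))        ≡⟨ reshuffleₗ n P (choose (r + r) 3) B ⟩
    P * P * choose (r + r) 3 * (n * n * n * B)      ≤⟨ *-mono-≤ (*-mono-≤ (*-mono-≤ P≤m P≤m) (choose≤^ (r + r) 3)) cubic ⟩
    m * m * (r + r) ^ 3 * (6 * (r * r * r) * N)     ≡⟨ reshuffleᵣ m r N ⟩
    48 * (N * (r ^ 6 * m ^ 2))                      ∎
    where
    open ≤-Reasoning
    reshuffleₗ : ∀ n P c B → n * (n * (n * 1)) * (P * P * (c * B)) ≡ P * P * c * (n * n * n * B)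
    reshuffleₗ = solve-∀
    reshuffleᵣ : ∀ m r N →
      m * m * ((r + r) * ((r + r) * ((r + r) * 1))) * (6 * (r * r * r) * N)
        ≡ 48 * (N * (r * (r * (r * (r * (r * (r * 1))))) * (m * (m * 1))))
    reshuffleᵣ = solve-∀

  cube*triples≤ : ∀ {P m} → 1 ≤ m → P ≤ m → n ^ 3 * (2 * (P * (choose r 3 * B))) ≤ 12 * (N * (r ^ 6 * m ^ 2))
  cube*triples≤ {P} {m} 1≤m P≤m = begin
    n ^ 3 * (2 * (P * (choose r 3 * B)))            ≡⟨ reshuffleₗ n P (choose r 3) B ⟩
    2 * P * choose r 3 * (n * n * n * B)            ≤⟨ *-mono-≤ (*-mono-≤ (*-monoʳ-≤ 2 P≤m*m) (choose≤^ r 3)) cubic ⟩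
    2 * (m * m) * r ^ 3 * (6 * (r * r * r) * N)     ≡⟨ reshuffleᵣ m r N ⟩
    12 * (N * (r ^ 6 * m ^ 2))                      ∎
    where
    open ≤-Reasoning
    P≤m*m : P ≤ m * m
    P≤m*m = ≤-trans P≤m (m≤m*n m m {{>-nonZero 1≤m}})
    reshuffleₗ : ∀ n P c B → n * (n * (n * 1)) * (2 * (P * (c * B))) ≡ 2 * P * c * (n * n * n * B)
    reshuffleₗ = solve-∀
    reshuffleᵣ : ∀ m r N →
      2 * (m * m) * (r * (r * (r * 1))) * (6 * (r * r * r) * N)
        ≡ 12 * (N * (r * (r * (r * (r * (r * (r * 1))))) * (m * (m * 1))))
    reshuffleᵣ = solve-∀

cube*deviation≤ : ∀ {n r m P N A B} → 1 ≤ r → 1 ≤ m → 1 ≤ A → P ≤ m →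
  n * n * A ≤ 2 * (r * r) * N → n * n * n * B ≤ 6 * (r * r * r) * N →
  n ^ 3 * (1 + choose r 2 * A + (P * P * (choose (r + r) 3 * B) + 2 * (P * (choose r 3 * B))))
    ≤ 64 * (N * (r ^ 4 * n + r ^ 6 * m ^ 2))
cube*deviation≤ {n} {r} {m} {P} {N} {A} {B} 1≤r 1≤m 1≤A P≤m quadratic cubic = begin
  n ^ 3 * (1 + choose r 2 * A + (P * P * (choose (r + r) 3 * B) + 2 * (P * (choose r 3 * B))))
    ≡⟨ distribute (n ^ 3) (choose r 2 * A) _ _ ⟩
  n ^ 3 + n ^ 3 * (choose r 2 * A)
    + (n ^ 3 * (P * P * (choose (r + r) 3 * B)) + n ^ 3 * (2 * (P * (choose r 3 * B))))
    ≤⟨ +-mono-≤ (+-mono-≤ (cube≤ {n} {r} {N} {A} quadratic 1≤r 1≤A)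
                          (cube*single≤ {n} {r} {N} {A} quadratic))
                (+-mono-≤ (cube*pairs≤ {n} {r} {N} {B} cubic {P} {m} P≤m)
                          (cube*triples≤ {n} {r} {N} {B} cubic {P} {m} 1≤m P≤m)) ⟩
  2 * a + a + (48 * b + 12 * b)
    ≤⟨ m≤m+n _ (61 * a + 4 * b) ⟩
  2 * a + a + (48 * b + 12 * b) + (61 * a + 4 * b)
    ≡⟨ collect a b ⟩
  64 * (a + b)
    ≡⟨ cong (64 *_) (*-distribˡ-+ N (r ^ 4 * n) (r ^ 6 * m ^ 2)) ⟨
  64 * (N * (r ^ 4 * n + r ^ 6 * m ^ 2))
    ∎
  where
  open ≤-Reasoning
  a = N * (r ^ 4 * n)
  b = N * (r ^ 6 * m ^ 2)
  distribute : ∀ x s p t → x * (1 + s + (p + t)) ≡ x + x * s + (x * p + x * t)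
  distribute = solve-∀
  collect : ∀ a b → 2 * a + a + (48 * b + 12 * b) + (61 * a + 4 * b) ≡ 64 * (a + b)
  collect = solve-∀

module _ {n r m : ℕ} (1≤m : 1 ≤ m) (growth : 16 * (m ^ 2 * r ^ 6) ≤ n ^ 3) where

  growth⇒r*r≤n : r * r ≤ n
  growth⇒r*r≤n = ≮⇒≥ λ n<r*r → <-irrefl refl (begin-strict
    n ^ 3                  <⟨ ^-monoˡ-< 3 n<r*r ⟩
    (r * r) ^ 3            ≡⟨ cube-square r ⟩
    r ^ 6                  ≤⟨ m≤n*m (r ^ 6) (m ^ 2) {{>-nonZero (^-monoˡ-≤ 2 1≤m)}} ⟩
    m ^ 2 * r ^ 6          ≤⟨ m≤n*m (m ^ 2 * r ^ 6) 16 ⟩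
    16 * (m ^ 2 * r ^ 6)   ≤⟨ growth ⟩
    n ^ 3                  ∎)
    where
    open ≤-Reasoning
    cube-square : ∀ r → r * r * (r * r * (r * r * 1)) ≡ r * (r * (r * (r * (r * (r * 1)))))
    cube-square = solve-∀

  growth⇒4mr⁴≤n² : 4 * (m * r ^ 4) ≤ n ^ 2
  growth⇒4mr⁴≤n² = ≮⇒≥ λ n²<4mr⁴ → <-irrefl refl (begin-strict
    (n ^ 2) ^ 2                      <⟨ ^-monoˡ-< 2 n²<4mr⁴ ⟩
    (4 * (m * r ^ 4)) ^ 2            ≡⟨ square-expand m r ⟩
    16 * (m ^ 2 * r ^ 6) * (r * r)   ≤⟨ *-mono-≤ growth growth⇒r*r≤n ⟩
    n ^ 3 * n                        ≡⟨ fourth-power n ⟩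
    (n ^ 2) ^ 2                      ∎)
    where
    open ≤-Reasoning
    square-expand : ∀ m r →
      4 * (m * (r * (r * (r * (r * 1))))) * (4 * (m * (r * (r * (r * (r * 1))))) * 1)
        ≡ 16 * (m * (m * 1) * (r * (r * (r * (r * (r * (r * 1))))))) * (r * r)
    square-expand = solve-∀
    fourth-power : ∀ n → n * (n * (n * 1)) * n ≡ n * (n * 1) * (n * (n * 1) * 1)
    fourth-power = solve-∀

[+m]-[+n]≡+[m∸n] : ∀ {m n} → n ≤ m → (+ m) -ℤ (+ n) ≡ + (m ∸ n)
[+m]-[+n]≡+[m∸n] {m} {n} n≤m = trans ([+m]-[+n]≡m⊖n m n) (⊖-≥ n≤m)

cardNr-estimate : ∀ {n r} m → 3 ≤ r → 3 ≤ n → 1 ≤ m → 16 * (m ^ 2 * r ^ 6) ≤ n ^ 3 →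
  (e : Subset n) (H : List (Subset n)) → InL r n (m ∸ 1) H →
  n ^ 3 * ∣ (+ cardNr r H e) -ℤ ((+ (n C r)) -ℤ (+ ((r C 2) * m * ((n ∸ 2) C (r ∸ 2))))) ∣
    ≤ 128 * ∣ (+ (n C r)) -ℤ (+ ((r C 2) * m * ((n ∸ 2) C (r ∸ 2)))) ∣ * (r ^ 4 * n + r ^ 6 * m ^ 2)
cardNr-estimate {_} {_} m (s≤s (s≤s (s≤s (z≤n {ρ})))) (s≤s (s≤s (s≤s (z≤n {ν})))) 1≤m growth
                e H ((_ , uniform) , linear , ∣H∣≡m-1) = begin
  n ^ 3 * ∣ (+ cardNr r H e) -ℤ ((+ (n C r)) -ℤ (+ X′)) ∣
    ≡⟨ cong (λ z → n ^ 3 * ∣ (+ cardNr r H e) -ℤ z ∣) N-X ⟩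
  n ^ 3 * ∣ (+ cardNr r H e) -ℤ (+ (N ∸ X)) ∣
    ≡⟨ cong (λ z → n ^ 3 * ∣ z ∣) ([+m]-[+n]≡m⊖n (cardNr r H e) (N ∸ X)) ⟩
  n ^ 3 * ∣ cardNr r H e ⊖ (N ∸ X) ∣
    ≤⟨ *-monoʳ-≤ (n ^ 3) (∸-deviation P≤m m≤1+P X≤N (cardNr-lower H e uniform)
                                                      (cardNr-upper H e uniform linear)) ⟩
  n ^ 3 * (1 + q * A + (P * P * (choose (r + r) 3 * B) + 2 * (P * (choose r 3 * B))))
    ≤⟨ cube*deviation≤ {n} {r} {m} {P} {N} {A} {B} (s≤s z≤n) 1≤m 1≤A P≤m quadratic cubic ⟩
  64 * (N * E)
    ≤⟨ *-monoʳ-≤ 64 (*-monoˡ-≤ E (N≤2[N∸x] {N} {X} 2X≤N)) ⟩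
  64 * (2 * (N ∸ X) * E)
    ≡⟨ double (N ∸ X) E ⟩
  128 * (N ∸ X) * E
    ≡⟨ cong (λ z → 128 * ∣ z ∣ * E) N-X ⟨
  128 * ∣ (+ (n C r)) -ℤ (+ X′) ∣ * E
    ∎
  where
  open ≤-Reasoning
  n = 3 + ν
  r = 3 + ρ
  N = choose n r
  q = choose r 2
  A = choose (1 + ν) (1 + ρ)
  B = choose ν ρ
  X = m * (q * A)
  X′ = (r C 2) * m * ((n ∸ 2) C (r ∸ 2))
  P = length H
  E = r ^ 4 * n + r ^ 6 * m ^ 2
  P≤m : P ≤ m
  P≤m = ≤-trans (≤-reflexive ∣H∣≡m-1) (m∸n≤m m 1)
  m≤1+P : m ≤ suc P
  m≤1+P = subst (λ k → m ≤ suc k) (sym ∣H∣≡m-1) (m≤n+m∸n m 1)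
  quadratic : n * n * A ≤ 2 * (r * r) * N
  quadratic = choose-quadratic-weight (1 + ν) (1 + ρ)
  cubic : n * n * n * B ≤ 6 * (r * r * r) * N
  cubic = choose-cubic-weight ν ρ
  r≤n : r ≤ n
  r≤n = ≤-trans (m≤m*n r r) (growth⇒r*r≤n {n} {r} {m} 1≤m growth)
  1≤A : 1 ≤ A
  1≤A = choose-pos (s≤s⁻¹ (s≤s⁻¹ r≤n))
  2X≤N : 2 * X ≤ N
  2X≤N = 2m*single≤N {n} {r} {N} {A} quadratic (s≤s z≤n) m
           (≤-trans (*-monoˡ-≤ (m * r ^ 4) (s≤s (s≤s (z≤n {2})))) (growth⇒4mr⁴≤n² {n} {r} {m} 1≤m growth))
  X≤N : X ≤ N
  X≤N = ≤-trans (m≤m+n X (X + 0)) 2X≤N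
  X′≡X : X′ ≡ X
  X′≡X = trans (cong₂ (λ u v → u * m * v) (C≡choose r 2) (C≡choose (1 + ν) (1 + ρ))) (*-comm-middle q m A)
    where
    *-comm-middle : ∀ q m A → q * m * A ≡ m * (q * A)
    *-comm-middle = solve-∀
  N-X : (+ (n C r)) -ℤ (+ X′) ≡ + (N ∸ X)
  N-X = trans (cong₂ (λ u v → (+ u) -ℤ (+ v)) (C≡choose n r) X′≡X) ([+m]-[+n]≡+[m∸n] X≤N)
  double : ∀ M E → 64 * (2 * M * E) ≡ 128 * M * E
  double = solve-∀

-- Only the subset e = e_i of [n] enters the count.
lemma10p1 : (r m : ℕ → ℕ) →
    (∀ n → 3 ≤ r n) → (∀ n → 1 ≤ m n) →
    (∀ k → 1 ≤ k → Σ ℕ λ n₀ → ∀ n → n ≥ n₀ → k * (m n ^ 2 * r n ^ 6) ≤ n ^ 3) →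
    Σ ℕ λ c → Σ ℕ λ n₀ → ∀ n → n ≥ n₀ →
    (K : List (Subset n)) → IsRGraph n (r n) K → IsLinear K →
    (i : Fin (length K)) →
    (H : List (Subset n)) → InL (r n) n (m n ∸ 1) H →
    n ^ 3 * ∣ (+ cardNr (r n) H (lookup K i)) -ℤ ((+ (n C (r n))) -ℤ (+ (((r n) C 2) * m n * ((n ∸ 2) C (r n ∸ 2))))) ∣
    ≤ c * ∣ (+ (n C (r n))) -ℤ (+ (((r n) C 2) * m n * ((n ∸ 2) C (r n ∸ 2)))) ∣ * (r n ^ 4 * n + r n ^ 6 * m n ^ 2)
lemma10p1 r m 3≤r 1≤m small = 128 , n₀ , λ n n≥n₀ K _ _ i →
  cardNr-estimate (m n) (3≤r n) (3≤n n n≥n₀) (1≤m n) (growth n n≥n₀) (lookup K i)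
  where
  n₀ = proj₁ (small 16 (s≤s z≤n))
  growth : ∀ n → n ≥ n₀ → 16 * (m n ^ 2 * r n ^ 6) ≤ n ^ 3
  growth = proj₂ (small 16 (s≤s z≤n))
  3≤n : ∀ n → n ≥ n₀ → 3 ≤ n
  3≤n n n≥n₀ = ≤-trans (3≤r n) (≤-trans (m≤m*n (r n) (r n) {{>-nonZero (≤-trans (s≤s z≤n) (3≤r n))}})
                                        (growth⇒r*r≤n {n} {r n} {m n} (1≤m n) (growth n n≥n₀)))
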